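{- There is a constant $C>0$ such that every string $s$ of length $n\ge 2$ contains at most $C\,n\log n$ right closed repeats and at most $C\,n\log n$ left closed repeats. (That is, the numbers of left closed repeats and of right closed repeats in a string of length $n$ are $O(n\log n)$.)
   Context: Let $s=s[1]s[2]\cdots s[n]$ be a string over some alphabet; $s[i\,..\,j]$ denotes the substring $s[i]s[i+1]\cdots s[j]$. A string $t$ occurs in $s$ at position $i$ if $s[i\,..\,i+|t|-1]=t$. A non-empty substring $s[i\,..\,j]$ is a right closed repeat (respectively, left closed repeat) if it has an occurrence $s[i'\,..\,j']=s[i\,..\,j]$ with $i'>i$ such that $s[i\,..\,j]$ does not occur at any of the positions $i+1,\dots,i'-1$, and either $j'=n$ or $s[j+1]\ne s[j'+1]$ (respectively, either $i=1$ or $s[i-1]\ne s[i'-1]$). The occurrence $s[i'\,..\,j']$ is called the next occurrence of $s[i\,..\,j]$. Repeats that are equal as strings but occur at different positions are counted as different. Logarithms are base 2. -}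

module Defs where

open import Data.Nat using (ℕ; zero; suc; _+_; _∸_; _≤_; _<_)
open import Data.Nat.Properties using (_<?_)
open import Data.Fin using (fromℕ<)
open import Data.Vec using (Vec; lookup)
open import Data.Maybe using (Maybe; just; nothing)
open import Data.Product using (Σ; _×_)
open import Data.Sum using (_⊎_)
open import Relation.Nullary using (¬_; yes; no)
open import Relation.Binary.PropositionalEquality using (_≡_; _≢_)

-- 1-indexed character access: at s m = just s[m] for 1 ≤ m ≤ n, nothing otherwise.
at : {A : Set} {n : ℕ} → Vec A n → ℕ → Maybe A
at s zero = nothing
at {n = n} s (suc m) with m <? n
... | yes m<n = just (lookup s (fromℕ< m<n))
... | no _ = nothing

OccursAt : {A : Set} {n : ℕ} → Vec A n → ℕ → ℕ → ℕ → Set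
OccursAt {n = n} s i j p =
  1 ≤ p × p + (j ∸ i) ≤ n × (∀ k → k ≤ j ∸ i → at s (p + k) ≡ at s (i + k))

Substring : {A : Set} {n : ℕ} → Vec A n → ℕ → ℕ → Set
Substring {n = n} s i j = 1 ≤ i × i ≤ j × j ≤ n

NextOcc : {A : Set} {n : ℕ} → Vec A n → ℕ → ℕ → ℕ → Set
NextOcc s i j i' =
  i < i' × OccursAt s i j i' × (∀ p → i < p → p < i' → ¬ OccursAt s i j p)

RightClosed : {A : Set} {n : ℕ} → Vec A n → ℕ → ℕ → Set
RightClosed {n = n} s i j = Substring s i j × Σ ℕ λ i' → NextOcc s i j i' ×
  (i' + (j ∸ i) ≡ n ⊎ at s (j + 1) ≢ at s (i' + (j ∸ i) + 1))

LeftClosed : {A : Set} {n : ℕ} → Vec A n → ℕ → ℕ → Set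
LeftClosed s i j = Substring s i j × Σ ℕ λ i' → NextOcc s i j i' ×
  (i ≡ 1 ⊎ at s (i ∸ 1) ≢ at s (i' ∸ 1))

-- For every depth m, call two positions equivalent when s agrees on the windows of
-- length m + 1 starting at them (for left closed repeats: ending at them); these
-- equivalences refine one another as m grows.  A right closed repeat s[i .. j] with next
-- occurrence at i' makes i and i' consecutive members of one class at depth m = j - i
-- that are separated at depth m + 1; a left closed repeat does the same for the end
-- positions j and i' + m.  The depth-(m + 1) classes of the two members are disjoint
-- parts of their common depth-m class, so one of them has at most half its size: charge
-- the repeat to that member and depth.  Along the chain of classes of a fixed position
-- such a halving happens at most ⌊log₂ n⌋ + 1 times, and a charge on the later member
-- determines the earlier one as its predecessor in the class.  Hence there are at most
-- 2 n (⌊log₂ n⌋ + 1) repeats of each kind.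
module Submission where

open import Defs
open import Data.Nat.Logarithm using (⌊log₂_⌋; ⌊log₂⌋-mono-≤; ⌊log₂[2*b]⌋≡1+⌊log₂b⌋)
open import Data.Nat.Base
  using (ℕ; zero; suc; _+_; _*_; _∸_; _≤_; _<_; z≤n; s≤s; s≤s⁻¹)
open import Data.Nat.Properties
open import Data.Nat.Solver using (module +-*-Solver)
open import Data.Bool.Base using (Bool; true; false)
open import Data.Fin.Base using (Fin; zero; suc; fromℕ<)
open import Data.Fin.Properties using (∀-cons)
open import Data.Vec.Base using (Vec; lookup)
open import Data.Maybe.Base using (nothing; just)
open import Data.Maybe.Properties using (just-injective)
open import Data.List.Base using (List; []; _∷_; _++_; length)
open import Data.List.Properties using (length-++; length-removeAt′)
open import Data.List.Relation.Unary.All as All using (All)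
open import Data.List.Relation.Unary.Any using (here; there; index; _─_)
open import Data.List.Relation.Unary.Unique.Propositional using (Unique; _∷_)
open import Data.List.Membership.Propositional using (_∈_)
open import Data.List.Membership.Propositional.Properties using (∈-++⁺ˡ; ∈-++⁺ʳ)
open import Data.Product.Base using (Σ; ∃-syntax; _×_; _,_; proj₁; uncurry)
open import Data.Product.Properties using (,-injective)
open import Data.Sum.Base using (_⊎_; inj₁; inj₂)
open import Function.Base using (_∘_)
open import Relation.Binary.Definitions using (tri<; tri≈; tri>)
open import Relation.Nullary.Decidable using (Dec; yes; no; map′; _×-dec_; decidable-stable; ¬¬-excluded-middle)
open import Relation.Nullary.Negation using (¬_; contradiction; ¬¬-map)
open import Level using (0ℓ)
open import Relation.Unary using (Pred; Decidable; _⊆_)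
open import Relation.Binary.PropositionalEquality

module _ {X : Set} where

  ∈-─⁺ : ∀ {x y : X} {ys} (x∈ys : x ∈ ys) → y ∈ ys → y ≢ x → y ∈ (ys ─ x∈ys)
  ∈-─⁺ (here refl) (here refl) y≢x = contradiction refl y≢x
  ∈-─⁺ (here refl) (there y∈ys) _   = y∈ys
  ∈-─⁺ (there _)   (here refl) _    = here refl
  ∈-─⁺ (there x∈ys) (there y∈ys) y≢x = there (∈-─⁺ x∈ys y∈ys y≢x)

module _ {X Y : Set} (R : X → Y → Set) where

  injective-relation⇒length≤ : ∀ {xs : List X} {ys : List Y} → Unique xs →
    (∀ {x x′ y} → x ∈ xs → x′ ∈ xs → R x y → R x′ y → x ≡ x′) →
    (∀ {x} → x ∈ xs → ∃[ y ] y ∈ ys × R x y) →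
    length xs ≤ length ys
  injective-relation⇒length≤ {[]} _ _ _ = z≤n
  injective-relation⇒length≤ {x ∷ xs} {ys} (x∉xs ∷ unique) injective image
    with image (here refl)
  ... | y , y∈ys , xRy = begin
    suc (length xs)          ≤⟨ s≤s (injective-relation⇒length≤ unique
                                       (λ p q → injective (there p) (there q)) image′) ⟩
    suc (length (ys ─ y∈ys)) ≡⟨ length-removeAt′ ys (index y∈ys) ⟨
    length ys                ∎
    where
    open ≤-Reasoning
    image′ : ∀ {x′} → x′ ∈ xs → ∃[ y′ ] y′ ∈ (ys ─ y∈ys) × R x′ y′
    image′ x′∈xs with image (there x′∈xs)
    ... | y′ , y′∈ys , x′Ry′ = y′ , ∈-─⁺ y∈ys y′∈ys y′≢y , x′Ry′
      where
      y′≢y : y′ ≢ y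
      y′≢y refl = All.lookup x∉xs x′∈xs (injective (here refl) (there x′∈xs) xRy x′Ry′)

countTo : {P : Pred ℕ 0ℓ} → Decidable P → ℕ → ℕ
countTo P? zero = 0
countTo P? (suc N) with P? (suc N)
... | yes _ = suc (countTo P? N)
... | no _  = countTo P? N

module _ {P Q : Pred ℕ 0ℓ} (P? : Decidable P) (Q? : Decidable Q) where

  countTo-mono : P ⊆ Q → ∀ N → countTo P? N ≤ countTo Q? N
  countTo-mono P⊆Q zero = z≤n
  countTo-mono P⊆Q (suc N) with P? (suc N) | Q? (suc N)
  ... | yes _  | yes _  = s≤s (countTo-mono P⊆Q N)
  ... | yes p  | no ¬q  = contradiction (P⊆Q p) ¬q
  ... | no _   | yes _  = m≤n⇒m≤1+n (countTo-mono P⊆Q N)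
  ... | no _   | no _   = countTo-mono P⊆Q N

  countTo-disjoint : {S : Pred ℕ 0ℓ} (S? : Decidable S) → P ⊆ S → Q ⊆ S →
    (∀ {p} → P p → ¬ Q p) → ∀ N → countTo P? N + countTo Q? N ≤ countTo S? N
  countTo-disjoint S? P⊆S Q⊆S disjoint zero = z≤n
  countTo-disjoint S? P⊆S Q⊆S disjoint (suc N)
    with P? (suc N) | Q? (suc N) | S? (suc N)
  ... | yes p | yes q | _     = contradiction q (disjoint p)
  ... | yes p | no _  | no ¬s = contradiction (P⊆S p) ¬s
  ... | no _  | yes q | no ¬s = contradiction (Q⊆S q) ¬s
  ... | yes _ | no _  | yes _ = s≤s (countTo-disjoint S? P⊆S Q⊆S disjoint N)
  ... | no _  | yes _ | yes _ = begin
    countTo P? N + suc (countTo Q? N) ≡⟨ +-suc (countTo P? N) (countTo Q? N) ⟩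
    suc (countTo P? N + countTo Q? N) ≤⟨ s≤s (countTo-disjoint S? P⊆S Q⊆S disjoint N) ⟩
    suc (countTo S? N)                ∎
    where open ≤-Reasoning
  ... | no _  | no _  | yes _ = m≤n⇒m≤1+n (countTo-disjoint S? P⊆S Q⊆S disjoint N)
  ... | no _  | no _  | no _  = countTo-disjoint S? P⊆S Q⊆S disjoint N

module _ {P : Pred ℕ 0ℓ} (P? : Decidable P) where

  countTo-pos : ∀ {p N} → P p → 1 ≤ p → p ≤ N → 1 ≤ countTo P? N
  countTo-pos {N = zero} _ () z≤n
  countTo-pos {p} {suc N} Pp 1≤p p≤N with P? (suc N)
  ... | yes _ = s≤s z≤n
  ... | no ¬P with m≤n⇒m<n∨m≡n p≤N
  ...   | inj₁ p<N    = countTo-pos Pp 1≤p (s≤s⁻¹ p<N)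
  ...   | inj₂ refl   = contradiction Pp ¬P

  countTo≤ : ∀ N → countTo P? N ≤ N
  countTo≤ zero = z≤n
  countTo≤ (suc N) with P? (suc N)
  ... | yes _ = s≤s (countTo≤ N)
  ... | no _  = m≤n⇒m≤1+n (countTo≤ N)

bits : ℕ → ℕ
bits zero    = 0
bits (suc b) = suc ⌊log₂ suc b ⌋

bits-mono-≤ : ∀ {a b} → a ≤ b → bits a ≤ bits b
bits-mono-≤ z≤n       = z≤n
bits-mono-≤ (s≤s a≤b) = s≤s (⌊log₂⌋-mono-≤ (s≤s a≤b))

bits-half : ∀ {a b} → 2 * a ≤ b → 1 ≤ b → bits a < bits b
bits-half {zero}  {suc b} _    _ = s≤s z≤n
bits-half {suc a} {suc b} 2a≤b _ = s≤s (begin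
  suc ⌊log₂ suc a ⌋     ≡⟨ ⌊log₂[2*b]⌋≡1+⌊log₂b⌋ (suc a) ⟨
  ⌊log₂ (2 * suc a) ⌋   ≤⟨ ⌊log₂⌋-mono-≤ 2a≤b ⟩
  ⌊log₂ suc b ⌋         ∎)
  where open ≤-Reasoning

smaller-half : ∀ x y c → x + y ≤ c → 2 * x ≤ c ⊎ 2 * y ≤ c
smaller-half x y c x+y≤c with ≤-total x y
... | inj₁ x≤y = inj₁ (≤-trans (+-mono-≤ ≤-refl (≤-trans (≤-reflexive (+-identityʳ x)) x≤y)) x+y≤c)
... | inj₂ y≤x = inj₂ (≤-trans (+-mono-≤ y≤x (≤-reflexive (+-identityʳ y))) x+y≤c)

record NestedEquivalences (n : ℕ) : Set₁ where
  field
    _≈[_]_     : ℕ → ℕ → ℕ → Set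
    _≈?[_]_    : ∀ p m q → Dec (p ≈[ m ] q)
    ≈-sym      : ∀ {m p q} → p ≈[ m ] q → q ≈[ m ] p
    ≈-trans    : ∀ {m p q r} → p ≈[ m ] q → q ≈[ m ] r → p ≈[ m ] r
    ≈-antitone : ∀ {m p q} → p ≈[ suc m ] q → p ≈[ m ] q
    ≈-bounded  : ∀ {m p q} → p ≈[ m ] q → 1 ≤ p × p ≤ n
    ≈-shallow  : ∀ {m p q} → p ≈[ m ] q → m < n

module Charging {n : ℕ} (E : NestedEquivalences n) where
  open NestedEquivalences E

  classSize : ℕ → ℕ → ℕ
  classSize m x = countTo (λ p → x ≈?[ m ] p) n

  classSize-antitone : ∀ m x → classSize (suc m) x ≤ classSize m x
  classSize-antitone m x = countTo-mono _ _ ≈-antitone n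

  classSize-cong : ∀ {m x y} → x ≈[ m ] y → classSize m x ≡ classSize m y
  classSize-cong x≈y = ≤-antisym (countTo-mono _ _ (≈-trans (≈-sym x≈y)) n)
                                 (countTo-mono _ _ (≈-trans x≈y) n)

  classSize-split : ∀ {m x y} → x ≈[ m ] y → ¬ x ≈[ suc m ] y →
    classSize (suc m) x + classSize (suc m) y ≤ classSize m x
  classSize-split x≈y x≉y = countTo-disjoint _ _ _ ≈-antitone (≈-trans x≈y ∘ ≈-antitone)
    (λ x≈p y≈p → x≉y (≈-trans x≈p (≈-sym y≈p))) n

  classSize-pos : ∀ {m x y} → x ≈[ m ] y → 1 ≤ classSize m x
  classSize-pos x≈y = uncurry (countTo-pos _ (≈-trans x≈y (≈-sym x≈y))) (≈-bounded x≈y)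

  Light : ℕ → ℕ → Set
  Light x m = 1 ≤ classSize m x × 2 * classSize (suc m) x ≤ classSize m x

  light? : ∀ x m → Dec (Light x m)
  light? x m = (1 ≤? classSize m x) ×-dec (2 * classSize (suc m) x ≤? classSize m x)

  light-or-light : ∀ {m x y} → x ≈[ m ] y → ¬ x ≈[ suc m ] y → Light x m ⊎ Light y m
  light-or-light {m} {x} {y} x≈y x≉y
    with smaller-half (classSize (suc m) x) (classSize (suc m) y) (classSize m x)
                      (classSize-split x≈y x≉y)
  ... | inj₁ x-light = inj₁ (classSize-pos x≈y , x-light)
  ... | inj₂ y-light = inj₂ (classSize-pos (≈-sym x≈y) ,
                             subst (2 * classSize (suc m) y ≤_) (classSize-cong x≈y) y-light)

  Token : Set
  Token = ℕ × ℕ × Bool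

  lightTokensOf : ℕ → ℕ → List Token
  lightTokensOf x zero = []
  lightTokensOf x (suc K) with light? x K
  ... | yes _ = (x , K , true) ∷ (x , K , false) ∷ lightTokensOf x K
  ... | no _  = lightTokensOf x K

  ∈-lightTokensOf : ∀ {x m K} side → Light x m → m < K → (x , m , side) ∈ lightTokensOf x K
  ∈-lightTokensOf {x} {m} {suc K} side light m<K with light? x K | m≤n⇒m<n∨m≡n (s≤s⁻¹ m<K)
  ∈-lightTokensOf true  _ _ | yes _ | inj₂ refl = here refl
  ∈-lightTokensOf false _ _ | yes _ | inj₂ refl = there (here refl)
  ... | yes _     | inj₁ m<K′ = there (there (∈-lightTokensOf side light m<K′))
  ... | no ¬light | inj₂ refl = contradiction light ¬light
  ... | no _      | inj₁ m<K′ = ∈-lightTokensOf side light m<K′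

  -- Every light level of x halves the size of its class, so costs one bit of it.
  length-lightTokensOf : ∀ x K →
    length (lightTokensOf x K) + 2 * bits (classSize K x) ≤ 2 * bits (classSize 0 x)
  length-lightTokensOf x zero = ≤-refl
  length-lightTokensOf x (suc K) with light? x K
  ... | yes (nonempty , halves) = begin
    2 + length (lightTokensOf x K) + 2 * bits (classSize (suc K) x)
      ≡⟨ solve 2 (λ l b → con 2 :+ l :+ con 2 :* b := l :+ con 2 :* (con 1 :+ b)) refl
               (length (lightTokensOf x K)) (bits (classSize (suc K) x)) ⟩
    length (lightTokensOf x K) + 2 * suc (bits (classSize (suc K) x))
      ≤⟨ +-monoʳ-≤ (length (lightTokensOf x K)) (*-monoʳ-≤ 2 (bits-half halves nonempty)) ⟩
    length (lightTokensOf x K) + 2 * bits (classSize K x)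
      ≤⟨ length-lightTokensOf x K ⟩
    2 * bits (classSize 0 x) ∎
    where
    open ≤-Reasoning
    open +-*-Solver
  ... | no _ = ≤-trans
    (+-monoʳ-≤ (length (lightTokensOf x K)) (*-monoʳ-≤ 2 (bits-mono-≤ (classSize-antitone K x))))
    (length-lightTokensOf x K)

  length-lightTokensOf≤ : ∀ x → length (lightTokensOf x n) ≤ 2 * bits n
  length-lightTokensOf≤ x = begin
    length (lightTokensOf x n)                                ≤⟨ m≤m+n _ _ ⟩
    length (lightTokensOf x n) + 2 * bits (classSize n x)     ≤⟨ length-lightTokensOf x n ⟩
    2 * bits (classSize 0 x)                                  ≤⟨ *-monoʳ-≤ 2 (bits-mono-≤ (countTo≤ _ n)) ⟩
    2 * bits n                                                ∎
    where open ≤-Reasoning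

  lightTokens : ℕ → List Token
  lightTokens zero    = []
  lightTokens (suc X) = lightTokensOf (suc X) n ++ lightTokens X

  ∈-lightTokens : ∀ {x m X} side → Light x m → 1 ≤ x × x ≤ X → m < n →
    (x , m , side) ∈ lightTokens X
  ∈-lightTokens {X = zero} _ _ (() , z≤n) _
  ∈-lightTokens {X = suc X} side light (1≤x , x≤X) m<n with m≤n⇒m<n∨m≡n x≤X
  ... | inj₂ refl = ∈-++⁺ˡ (∈-lightTokensOf side light m<n)
  ... | inj₁ x<X  = ∈-++⁺ʳ (lightTokensOf (suc X) n) (∈-lightTokens side light (1≤x , s≤s⁻¹ x<X) m<n)

  length-lightTokens : ∀ X → length (lightTokens X) ≤ X * (2 * bits n)
  length-lightTokens zero    = z≤n
  length-lightTokens (suc X) = begin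
    length (lightTokensOf (suc X) n ++ lightTokens X)        ≡⟨ length-++ (lightTokensOf (suc X) n) ⟩
    length (lightTokensOf (suc X) n) + length (lightTokens X) ≤⟨ +-mono-≤ (length-lightTokensOf≤ (suc X))
                                                                            (length-lightTokens X) ⟩
    2 * bits n + X * (2 * bits n)                            ∎
    where open ≤-Reasoning

  NextAt : ℕ → ℕ → ℕ → Set
  NextAt m a b = a < b × a ≈[ m ] b × (∀ p → a < p → p < b → ¬ a ≈[ m ] p)

  NextAt-injective : ∀ {m a a′ b} → NextAt m a b → NextAt m a′ b → a ≡ a′
  NextAt-injective {a = a} {a′} (a<b , a≈b , between) (a′<b , a′≈b , between′) with <-cmp a a′
  ... | tri< a<a′ _ _ = contradiction (≈-trans a≈b (≈-sym a′≈b)) (between a′ a<a′ a′<b)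
  ... | tri≈ _ a≡a′ _ = a≡a′
  ... | tri> _ _ a′<a = contradiction (≈-trans a′≈b (≈-sym a≈b)) (between′ a a′<a a<b)

  Splits : ℕ × ℕ → Set
  Splits (a , m) = ∃[ b ] NextAt m a b × ¬ a ≈[ suc m ] b

  ChargedTo : ℕ × ℕ → Token → Set
  ChargedTo (a , m) (x , m′ , true)  = x ≡ a × m′ ≡ m
  ChargedTo (a , m) (x , m′ , false) = m′ ≡ m × NextAt m a x

  ChargedTo-injective : ∀ {u v t} → ChargedTo u t → ChargedTo v t → u ≡ v
  ChargedTo-injective {t = _ , _ , true}  (refl , refl) (refl , refl) = refl
  ChargedTo-injective {t = _ , _ , false} (refl , next) (refl , next′) =
    cong (_, _) (NextAt-injective next next′)

  charge : ∀ {u} → Splits u → ∃[ t ] t ∈ lightTokens n × ChargedTo u t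
  charge {a , m} (b , next@(_ , a≈b , _) , a≉b) with light-or-light a≈b a≉b
  ... | inj₁ a-light = (a , m , true) ,
    ∈-lightTokens true a-light (≈-bounded a≈b) (≈-shallow a≈b) , refl , refl
  ... | inj₂ b-light = (b , m , false) ,
    ∈-lightTokens false b-light (≈-bounded (≈-sym a≈b)) (≈-shallow a≈b) , refl , next

  splits⇒length≤ : {X : Set} (key : X → ℕ × ℕ) {xs : List X} → Unique xs →
    (∀ {x y} → x ∈ xs → y ∈ xs → key x ≡ key y → x ≡ y) →
    (∀ {x} → x ∈ xs → Splits (key x)) →
    length xs ≤ n * (2 * bits n)
  splits⇒length≤ key unique key-injective splits =
    ≤-trans (injective-relation⇒length≤ (ChargedTo ∘ key) unique
              (λ x∈ y∈ cx cy → key-injective x∈ y∈ (ChargedTo-injective cx cy))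
              (charge ∘ splits))
            (length-lightTokens n)

¬¬-∀-Fin : ∀ {m} {P : Fin m → Set} → (∀ i → ¬ ¬ P i) → ¬ ¬ (∀ i → P i)
¬¬-∀-Fin {zero}  _   k = k λ ()
¬¬-∀-Fin {suc m} ¬¬P k = ¬¬P zero λ P₀ → ¬¬-∀-Fin (¬¬P ∘ suc) λ P₊ → k (∀-cons P₀ P₊)

m+suc[n]≡m+n+1 : ∀ x m → x + suc m ≡ x + m + 1
m+suc[n]≡m+n+1 x m = trans (cong (x +_) (+-comm 1 m)) (sym (+-assoc x m 1))

m+n∸suc[n]≡m∸1 : ∀ x m → x + m ∸ suc m ≡ x ∸ 1
m+n∸suc[n]≡m∸1 x m = trans (cong₂ _∸_ (+-comm x m) (+-comm 1 m)) ([m+n]∸[m+o]≡n∸o m x 1)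

module _ {A : Set} {n : ℕ} (s : Vec A n) where

  at-cases : ∀ p → at s p ≡ nothing ⊎ ∃[ i ] at s p ≡ just (lookup s i)
  at-cases zero = inj₁ refl
  at-cases (suc p) with p <? n
  ... | yes p<n = inj₂ (fromℕ< p<n , refl)
  ... | no _    = inj₁ refl

  at-≟ : (∀ i j → Dec (lookup s i ≡ lookup s j)) → ∀ p q → Dec (at s p ≡ at s q)
  at-≟ _≟_ p q with at-cases p | at-cases q
  ... | inj₁ p↦ | inj₁ q↦ rewrite p↦ | q↦ = yes refl
  ... | inj₁ p↦ | inj₂ (_ , q↦) rewrite p↦ | q↦ = no λ ()
  ... | inj₂ (_ , p↦) | inj₁ q↦ rewrite p↦ | q↦ = no λ ()
  ... | inj₂ (i , p↦) | inj₂ (j , q↦) rewrite p↦ | q↦ = map′ (cong just) just-injective (i ≟ j)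

  ¬¬-at-≟ : ¬ ¬ (∀ p q → Dec (at s p ≡ at s q))
  ¬¬-at-≟ = ¬¬-map at-≟ (¬¬-∀-Fin λ _ → ¬¬-∀-Fin λ _ → ¬¬-excluded-middle)

  Agree : (ℕ → ℕ → ℕ) → ℕ → ℕ → ℕ → Set
  Agree shift m p q = ∀ k → k ≤ m → at s (shift p k) ≡ at s (shift q k)

  module _ {shift : ℕ → ℕ → ℕ} where

    Agree-sym : ∀ {m p q} → Agree shift m p q → Agree shift m q p
    Agree-sym agree k k≤m = sym (agree k k≤m)

    Agree-trans : ∀ {m p q r} → Agree shift m p q → Agree shift m q r → Agree shift m p r
    Agree-trans pq qr k k≤m = trans (pq k k≤m) (qr k k≤m)

    Agree-antitone : ∀ {m p q} → Agree shift (suc m) p q → Agree shift m p q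
    Agree-antitone agree k k≤m = agree k (m≤n⇒m≤1+n k≤m)

  Agree-+⇒∸ : ∀ {m p q} → Agree _+_ m p q → Agree _∸_ m (p + m) (q + m)
  Agree-+⇒∸ {m} {p} {q} agree k k≤m = begin
    at s (p + m ∸ k)   ≡⟨ cong (at s) (+-∸-assoc p k≤m) ⟩
    at s (p + (m ∸ k)) ≡⟨ agree (m ∸ k) (m∸n≤m m k) ⟩
    at s (q + (m ∸ k)) ≡⟨ cong (at s) (+-∸-assoc q k≤m) ⟨
    at s (q + m ∸ k)   ∎
    where open ≡-Reasoning

  Agree-∸⇒+ : ∀ {m p q} → Agree _∸_ m (p + m) (q + m) → Agree _+_ m p q
  Agree-∸⇒+ {m} {p} {q} agree k k≤m = begin
    at s (p + k)             ≡⟨ cong (at s) (mirror p) ⟨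
    at s (p + m ∸ (m ∸ k))   ≡⟨ agree (m ∸ k) (m∸n≤m m k) ⟩
    at s (q + m ∸ (m ∸ k))   ≡⟨ cong (at s) (mirror q) ⟩
    at s (q + k)             ∎
    where
    open ≡-Reasoning
    mirror : ∀ x → x + m ∸ (m ∸ k) ≡ x + k
    mirror x = trans (+-∸-assoc x (m∸n≤m m k)) (cong (x +_) (m∸[m∸n]≡n k≤m))

  module Windows (_≟ₛ_ : ∀ p q → Dec (at s p ≡ at s q)) where

    Agree? : ∀ shift m p q → Dec (Agree shift m p q)
    Agree? shift m p q = map′ (λ all k k≤m → all (s≤s k≤m))
                              (λ agree {k} k<1+m → agree k (s≤s⁻¹ k<1+m))
                              (allUpTo? (λ k → shift p k ≟ₛ shift q k) (suc m))

    windowed : (shift : ℕ → ℕ → ℕ) (Fits : ℕ → ℕ → Set) → (∀ m p → Dec (Fits m p)) →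
      (∀ {m p} → Fits (suc m) p → Fits m p) → (∀ {m p} → Fits m p → 1 ≤ p × p ≤ n) →
      (∀ {m p} → Fits m p → m < n) → NestedEquivalences n
    windowed shift Fits fits? shrink bounded shallow = record
      { _≈[_]_     = λ p m q → Fits m p × Fits m q × Agree shift m p q
      ; _≈?[_]_    = λ p m q → fits? m p ×-dec fits? m q ×-dec Agree? shift m p q
      ; ≈-sym      = λ (fp , fq , agree) → fq , fp , Agree-sym {shift = shift} agree
      ; ≈-trans    = λ (fp , _ , pq) (_ , fr , qr) → fp , fr , Agree-trans {shift = shift} pq qr
      ; ≈-antitone = λ (fp , fq , agree) → shrink fp , shrink fq , Agree-antitone {shift = shift} agree
      ; ≈-bounded  = bounded ∘ proj₁
      ; ≈-shallow  = shallow ∘ proj₁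
      }

    right : NestedEquivalences n
    right = windowed _+_ (λ m p → 1 ≤ p × p + m ≤ n) (λ m p → (1 ≤? p) ×-dec (p + m ≤? n))
      (λ {m} {p} (1≤p , end≤n) → 1≤p , ≤-trans (+-monoʳ-≤ p (n≤1+n m)) end≤n)
      (λ {m} {p} (1≤p , end≤n) → 1≤p , ≤-trans (m≤m+n p m) end≤n)
      (λ {m} (1≤p , end≤n) → ≤-trans (+-monoˡ-≤ m 1≤p) end≤n)

    left : NestedEquivalences n
    left = windowed _∸_ (λ m p → m < p × p ≤ n) (λ m p → (m <? p) ×-dec (p ≤? n))
      (λ (1+m<p , p≤n) → <⇒≤ 1+m<p , p≤n)
      (λ (m<p , p≤n) → ≤-trans (s≤s z≤n) m<p , p≤n)
      (λ (m<p , p≤n) → <-≤-trans m<p p≤n)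

    open NestedEquivalences right using () renaming (_≈[_]_ to _≈ᴿ[_]_)
    open NestedEquivalences left using () renaming (_≈[_]_ to _≈ᴸ[_]_)
    module Right = Charging right
    module Left = Charging left

    occursAt⇒≈ᴿ : ∀ {i j p} → Substring s i j → OccursAt s i j p → i ≈ᴿ[ j ∸ i ] p
    occursAt⇒≈ᴿ (1≤i , i≤j , j≤n) (1≤p , end≤n , agree) =
      (1≤i , subst (_≤ n) (sym (m+[n∸m]≡n i≤j)) j≤n) , (1≤p , end≤n) , λ k k≤m → sym (agree k k≤m)

    ≈ᴿ⇒occursAt : ∀ {i j p} → i ≈ᴿ[ j ∸ i ] p → OccursAt s i j p
    ≈ᴿ⇒occursAt (_ , (1≤p , end≤n) , agree) = 1≤p , end≤n , λ k k≤m → sym (agree k k≤m)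

    ≈ᴿ⇒≈ᴸ : ∀ {m p q} → p ≈ᴿ[ m ] q → (p + m) ≈ᴸ[ m ] (q + m)
    ≈ᴿ⇒≈ᴸ {m} ((1≤p , p+m≤n) , (1≤q , q+m≤n) , agree) =
      (+-monoˡ-≤ m 1≤p , p+m≤n) , (+-monoˡ-≤ m 1≤q , q+m≤n) , Agree-+⇒∸ agree

    ≈ᴸ⇒≈ᴿ : ∀ {m p q} → (p + m) ≈ᴸ[ m ] (q + m) → p ≈ᴿ[ m ] q
    ≈ᴸ⇒≈ᴿ {m} {p} {q} ((m<p+m , p+m≤n) , (m<q+m , q+m≤n) , agree) =
      (+-cancelʳ-≤ m 1 p m<p+m , p+m≤n) , (+-cancelʳ-≤ m 1 q m<q+m , q+m≤n) , Agree-∸⇒+ agree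

    nextOcc⇒nextᴿ : ∀ {i j i′} → Substring s i j → NextOcc s i j i′ → Right.NextAt (j ∸ i) i i′
    nextOcc⇒nextᴿ sub (i<i′ , occ , none-between) =
      i<i′ , occursAt⇒≈ᴿ sub occ , λ p i<p p<i′ → none-between p i<p p<i′ ∘ ≈ᴿ⇒occursAt

    nextOcc⇒nextᴸ : ∀ {i j i′} → Substring s i j → NextOcc s i j i′ →
      Left.NextAt (j ∸ i) j (i′ + (j ∸ i))
    nextOcc⇒nextᴸ {i} {j} {i′} sub@(_ , i≤j , _) (i<i′ , occ , none-between) = j<b , j≈b , between
      where
      m = j ∸ i
      i+m≡j : i + m ≡ j
      i+m≡j = m+[n∸m]≡n i≤j
      j<b : j < i′ + m
      j<b = subst (_< i′ + m) i+m≡j (+-monoˡ-< m i<i′)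
      j≈b : j ≈ᴸ[ m ] (i′ + m)
      j≈b = subst (_≈ᴸ[ m ] (i′ + m)) i+m≡j (≈ᴿ⇒≈ᴸ (occursAt⇒≈ᴿ sub occ))
      between : ∀ p → j < p → p < i′ + m → ¬ j ≈ᴸ[ m ] p
      between p j<p p<b j≈p = none-between (p ∸ m) i<p∸m p∸m<i′
        (≈ᴿ⇒occursAt (≈ᴸ⇒≈ᴿ (subst₂ _≈ᴸ[ m ]_ (sym i+m≡j) (sym p∸m+m≡p) j≈p)))
        where
        p∸m+m≡p : p ∸ m + m ≡ p
        p∸m+m≡p = m∸n+n≡m (≤-trans (m∸n≤m j i) (<⇒≤ j<p))
        i<p∸m : i < p ∸ m
        i<p∸m = +-cancelʳ-< m i (p ∸ m) (subst₂ _<_ (sym i+m≡j) (sym p∸m+m≡p) j<p)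
        p∸m<i′ : p ∸ m < i′
        p∸m<i′ = +-cancelʳ-< m (p ∸ m) i′ (subst (_< i′ + m) (sym p∸m+m≡p) p<b)

    rightClosed⇒splits : ∀ {i j} → RightClosed s i j → Right.Splits (i , j ∸ i)
    rightClosed⇒splits {i} {j} (sub@(_ , i≤j , _) , i′ , next , closed) =
      i′ , nextOcc⇒nextᴿ sub next , separated closed
      where
      m = j ∸ i
      separated : i′ + m ≡ n ⊎ at s (j + 1) ≢ at s (i′ + m + 1) → ¬ i ≈ᴿ[ suc m ] i′
      separated (inj₁ end≡n) (_ , (_ , end≤n) , _) =
        1+n≰n (subst (λ e → suc e ≤ n) end≡n (subst (_≤ n) (+-suc i′ m) end≤n))
      separated (inj₂ differ) (_ , _ , agree) = differ (begin
        at s (j + 1)       ≡⟨ cong (λ e → at s (e + 1)) (m+[n∸m]≡n i≤j) ⟨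
        at s (i + m + 1)   ≡⟨ cong (at s) (m+suc[n]≡m+n+1 i m) ⟨
        at s (i + suc m)   ≡⟨ agree (suc m) ≤-refl ⟩
        at s (i′ + suc m)  ≡⟨ cong (at s) (m+suc[n]≡m+n+1 i′ m) ⟩
        at s (i′ + m + 1)  ∎)
        where open ≡-Reasoning

    leftClosed⇒splits : ∀ {i j} → LeftClosed s i j → Left.Splits (j , j ∸ i)
    leftClosed⇒splits {i} {j} (sub@(_ , i≤j , _) , i′ , next , closed) =
      i′ + m , nextOcc⇒nextᴸ sub next , separated closed
      where
      m = j ∸ i
      separated : i ≡ 1 ⊎ at s (i ∸ 1) ≢ at s (i′ ∸ 1) → ¬ j ≈ᴸ[ suc m ] (i′ + m)
      separated (inj₁ refl) ((1+m<j , _) , _) = <-irrefl (m+[n∸m]≡n i≤j) 1+m<j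
      separated (inj₂ differ) (_ , _ , agree) = differ (begin
        at s (i ∸ 1)           ≡⟨ cong (at s) (m+n∸suc[n]≡m∸1 i m) ⟨
        at s (i + m ∸ suc m)   ≡⟨ cong (λ e → at s (e ∸ suc m)) (m+[n∸m]≡n i≤j) ⟩
        at s (j ∸ suc m)       ≡⟨ agree (suc m) ≤-refl ⟩
        at s (i′ + m ∸ suc m)  ≡⟨ cong (at s) (m+n∸suc[n]≡m∸1 i′ m) ⟩
        at s (i′ ∸ 1)          ∎)
        where open ≡-Reasoning

    rightClosed-count : ∀ {L} → Unique L → All (uncurry (RightClosed s)) L →
      length L ≤ n * (2 * bits n)
    rightClosed-count {L} unique closed = Right.splits⇒length≤ (λ (i , j) → i , j ∸ i) unique
      (λ x∈L y∈L → start-length-injective (substring x∈L) (substring y∈L))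
      (rightClosed⇒splits ∘ All.lookup closed)
      where
      substring : ∀ {x} → x ∈ L → uncurry (Substring s) x
      substring = proj₁ ∘ All.lookup closed
      start-length-injective : ∀ {i j i′ j′} → Substring s i j → Substring s i′ j′ →
        (i , j ∸ i) ≡ (i′ , j′ ∸ i′) → (i , j) ≡ (i′ , j′)
      start-length-injective (_ , i≤j , _) (_ , i′≤j′ , _) eq with refl , m≡m′ ← ,-injective eq =
        cong (_ ,_) (∸-cancelʳ-≡ i≤j i′≤j′ m≡m′)

    leftClosed-count : ∀ {L} → Unique L → All (uncurry (LeftClosed s)) L →
      length L ≤ n * (2 * bits n)
    leftClosed-count {L} unique closed = Left.splits⇒length≤ (λ (i , j) → j , j ∸ i) unique
      (λ x∈L y∈L → end-length-injective (substring x∈L) (substring y∈L))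
      (leftClosed⇒splits ∘ All.lookup closed)
      where
      substring : ∀ {x} → x ∈ L → uncurry (Substring s) x
      substring = proj₁ ∘ All.lookup closed
      end-length-injective : ∀ {i j i′ j′} → Substring s i j → Substring s i′ j′ →
        (j , j ∸ i) ≡ (j′ , j′ ∸ i′) → (i , j) ≡ (i′ , j′)
      end-length-injective (_ , i≤j , _) (_ , i′≤j′ , _) eq with refl , m≡m′ ← ,-injective eq =
        cong (_, _) (∸-cancelˡ-≡ i≤j i′≤j′ m≡m′)

-- Counting class members needs decidable equality of the characters of s, which holds
-- only up to double negation; that suffices because the bound is a decidable statement.
module _ {A : Set} {n : ℕ} (s : Vec A n) {L : List (ℕ × ℕ)} (unique : Unique L) where

  rightClosed-bound : All (uncurry (RightClosed s)) L → length L ≤ n * (2 * bits n)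
  rightClosed-bound closed = decidable-stable (_ ≤? _)
    (¬¬-map (λ _≟ₛ_ → Windows.rightClosed-count s _≟ₛ_ unique closed) (¬¬-at-≟ s))

  leftClosed-bound : All (uncurry (LeftClosed s)) L → length L ≤ n * (2 * bits n)
  leftClosed-bound closed = decidable-stable (_ ≤? _)
    (¬¬-map (λ _≟ₛ_ → Windows.leftClosed-count s _≟ₛ_ unique closed) (¬¬-at-≟ s))

n*[2*bits[n]]≤4*n*⌊log₂n⌋ : ∀ n → 2 ≤ n → n * (2 * bits n) ≤ 4 * n * ⌊log₂ n ⌋
n*[2*bits[n]]≤4*n*⌊log₂n⌋ n@(suc _) 2≤n = begin
  n * (2 * suc lg)     ≤⟨ *-monoʳ-≤ n (*-monoʳ-≤ 2 (+-monoˡ-≤ lg (⌊log₂⌋-mono-≤ 2≤n))) ⟩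
  n * (2 * (lg + lg))  ≡⟨ solve 2 (λ n lg → n :* (con 2 :* (lg :+ lg)) := con 4 :* n :* lg) refl n lg ⟩
  4 * n * lg           ∎
  where
  open ≤-Reasoning
  open +-*-Solver
  lg = ⌊log₂ n ⌋

theorem1 : Σ ℕ λ C → (A : Set) (n : ℕ) → 2 ≤ n → (s : Vec A n) → (L : List (ℕ × ℕ)) → Unique L →
             (All (uncurry (RightClosed s)) L → length L ≤ C * n * ⌊log₂ n ⌋) ×
             (All (uncurry (LeftClosed s)) L → length L ≤ C * n * ⌊log₂ n ⌋)
theorem1 = 4 , λ A n 2≤n s L unique →
  (λ closed → ≤-trans (rightClosed-bound s unique closed) (n*[2*bits[n]]≤4*n*⌊log₂n⌋ n 2≤n)) ,
  (λ closed → ≤-trans (leftClosed-bound s unique closed) (n*[2*bits[n]]≤4*n*⌊log₂n⌋ n 2≤n))
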